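{- Let $C$ be a $2$-dimensional hypercut over $\mathbb{F}_2$ on vertex set $[n]$, let $x\in[n]$, and let $\bar G={\rm link}_x(\bar C)$, where $\bar C=\binom{[n]}{3}\setminus C$; suppose $\bar G$ is connected and has no clones. Let $m$ be the number of edges of $\bar G$ and $d_1\ge d_2\ge\dots\ge d_{n-1}$ its degree sequence. Then for every $k$ with $1\le k\le n-1$, $\sum_{i=1}^k d_i\le m-\frac n2+\frac{k^2}{2}+2^k$.
   Context: A $2$-dimensional hypercut over $\mathbb{F}_2$ on $[n]$ is an inclusion-minimal set of triples meeting every maximal $\mathbb{F}_2$-acyclic set of triples (a set of triples is acyclic if the indicator vectors of their boundaries $\{ab,bc,ac\}$ are linearly independent over $\mathbb{F}_2$). For a set $D$ of triples, $\mathrm{link}_x(D)$ is the graph on $[n]\setminus\{x\}$ whose edges are the pairs $\{a,b\}$ with $\{x,a,b\}\in D$. Two vertices are clones if they have the same neighbour set. -}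

module Defs where

open import Data.Bool using (Bool; true; false; not; _∧_; T)
open import Data.Nat using (ℕ; zero; suc; _+_; _*_; _≤_; _^_)
open import Data.Nat.Properties using (≤-decTotalOrder)
open import Data.Nat.Divisibility using (_∣_)
open import Data.Fin using (Fin; _<_; _<?_; _≟_)
open import Data.List using (List; []; _∷_; concatMap; length; filterᵇ; map; take; reverse; allFin)
open import Data.Product using (Σ; ∃; _×_; _,_)
open import Relation.Nullary using (¬_; does)
open import Relation.Binary.PropositionalEquality using (_≡_; _≢_)
open import Data.List.Sort ≤-decTotalOrder using (sort)
open import Data.Bool.ListAction using (any)
open import Data.Nat.ListAction using (sum)

record Triple (n : ℕ) : Set where
  constructor tri
  field
    a b c : Fin n
    a<b : a < b
    b<c : b < c

mkTri : ∀ {n} → Fin n → Fin n → Fin n → List (Triple n)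
mkTri a b c with a <? b | b <? c
... | Relation.Nullary.yes p | Relation.Nullary.yes q = tri a b c p q ∷ []
... | _ | _ = []

triples : (n : ℕ) → List (Triple n)
triples n = concatMap (λ a → concatMap (λ b → concatMap (λ c → mkTri a b c) (allFin n)) (allFin n)) (allFin n)

TSet : ℕ → Set
TSet n = Triple n → Bool

_⊆ₜ_ : ∀ {n} → TSet n → TSet n → Set
S ⊆ₜ S' = ∀ t → S t ≡ true → S' t ≡ true

compl : ∀ {n} → TSet n → TSet n
compl C t = not (C t)

_∈ₜ_ : ∀ {n} → Fin n → Triple n → Bool
v ∈ₜ tri a b c _ _ = does (v ≟ a) Data.Bool.∨ does (v ≟ b) Data.Bool.∨ does (v ≟ c)

countT : ∀ {n} → TSet n → ℕ
countT {n} P = length (filterᵇ P (triples n))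

-- The F₂-sum of the boundaries of the triples in T is zero:
-- every pair {u,v} (u < v) lies in an even number of triples of T.
BoundaryZero : ∀ {n} → TSet n → Set
BoundaryZero {n} T' = ∀ (u v : Fin n) → u < v →
  2 ∣ countT (λ t → T' t ∧ (u ∈ₜ t) ∧ (v ∈ₜ t))

-- Acyclic over F₂: boundary vectors linearly independent, i.e. no nonempty
-- subset of S has boundaries summing to zero (coefficients in F₂ = subsets).
Acyclic : ∀ {n} → TSet n → Set
Acyclic S = ∀ T' → T' ⊆ₜ S → (∃ λ t → T' t ≡ true) → ¬ BoundaryZero T'

MaxAcyclic : ∀ {n} → TSet n → Set
MaxAcyclic S = Acyclic S × (∀ S' → S ⊆ₜ S' → Acyclic S' → S' ⊆ₜ S)

MeetsAllMaxAcyclic : ∀ {n} → TSet n → Set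
MeetsAllMaxAcyclic {n} C = ∀ S → MaxAcyclic S → ∃ λ t → C t ≡ true × S t ≡ true

Hypercut : ∀ {n} → TSet n → Set
Hypercut C = MeetsAllMaxAcyclic C × (∀ C' → C' ⊆ₜ C → MeetsAllMaxAcyclic C' → C ⊆ₜ C')

linkAdj : ∀ {n} → TSet n → Fin n → Fin n → Fin n → Bool
linkAdj {n} D x a b =
  not (does (a ≟ x)) ∧ not (does (b ≟ x)) ∧ not (does (a ≟ b)) ∧
  any (λ t → D t ∧ (x ∈ₜ t) ∧ (a ∈ₜ t) ∧ (b ∈ₜ t)) (triples n)

linkVerts : ∀ {n} → Fin n → List (Fin n)
linkVerts {n} x = filterᵇ (λ v → not (does (v ≟ x))) (allFin n)

data Reach {n} (adj : Fin n → Fin n → Bool) : Fin n → Fin n → Set where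
  here : ∀ {a} → Reach adj a a
  step : ∀ {a b c} → adj a b ≡ true → Reach adj b c → Reach adj a c

Connected : ∀ {n} → TSet n → Fin n → Set
Connected D x = ∀ a b → a ≢ x → b ≢ x → Reach (linkAdj D x) a b

NoClones : ∀ {n} → TSet n → Fin n → Set
NoClones D x = ∀ u v → u ≢ x → v ≢ x →
  (∀ w → linkAdj D x u w ≡ linkAdj D x v w) → u ≡ v

degree : ∀ {n} → TSet n → Fin n → Fin n → ℕ
degree {n} D x v = length (filterᵇ (linkAdj D x v) (allFin n))

edgeCount : ∀ {n} → TSet n → Fin n → ℕ
edgeCount {n} D x = length (filterᵇ (λ p → linkAdj D x (Data.Product.proj₁ p) (Data.Product.proj₂ p) ∧ does (Data.Product.proj₁ p <? Data.Product.proj₂ p))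
  (concatMap (λ a → map (λ b → (a , b)) (allFin n)) (allFin n)))

degreeSeq : ∀ {n} → TSet n → Fin n → List ℕ
degreeSeq D x = reverse (sort (map (degree D x) (linkVerts x)))

topSum : ∀ {n} → TSet n → Fin n → ℕ → ℕ
topSum D x k = sum (take k (degreeSeq D x))

module Submission where

-- The bound only uses that the link graph G = link_x(C̄) has no clones.
--
-- Let S be the set of vertices carrying the k largest degrees (|S| = K ≤ k),
-- write e(P,Q) for the number of ordered adjacent pairs (v,w) with v ∈ P and
-- w ∈ Q, and X for the complement of S. Double counting gives
--   d(S) = e(S,S) + e(S,X)   and   2m = e(S,S) + 2·e(S,X) + e(X,X),
-- hence 2·d(S) + e(X,X) = e(S,S) + 2m, with e(S,S) ≤ K².
-- Every vertex of X either has a neighbour in X (counted by e(X,X)), is x,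
-- or has all its neighbours in S; no two vertices of the last kind are
-- clones, so their neighbourhoods (all inside S) differ and there are at most
-- 2^K of them. Thus n ≤ K + e(X,X) + 1 + 2^K, and adding the two estimates
-- gives 2·d(S) + n ≤ 2m + K² + (K + 1) + 2^K ≤ 2m + k² + 2·2^k.

open import Defs

open import Data.Bool using (Bool; true; false; not; _∧_; _∨_)
open import Data.Bool.Properties using (∧-comm)
open import Data.Bool.ListAction using (or)
open import Data.Fin using (Fin; zero; suc; _≟_; _<?_)
open import Data.Fin.Properties using (<-cmp; suc-injective)
open import Data.List using (List; []; _∷_; length; filterᵇ; map; tabulate; allFin; concatMap; take; _++_)
open import Data.List.Membership.Propositional using (_∈_)
open import Data.List.Relation.Unary.Any using (any?; here; there)
open import Data.List.Properties using (map-cong; map-tabulate; filter-++; length-++; take-map; length-take)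
open import Data.List.Relation.Binary.Permutation.Propositional using (_↭_; ↭-sym; ↭-trans; ↭⇒↭ₛ)
open import Data.List.Relation.Binary.Permutation.Propositional.Properties using (↭-map-inv; ↭-reverse)
open import Data.List.Relation.Binary.Permutation.Setoid.Properties using (Unique-resp-↭)
import Data.List.Relation.Unary.All as All
open import Data.List.Relation.Unary.Unique.Propositional using (Unique; []; _∷_)
open import Data.List.Relation.Unary.Unique.Propositional.Properties using (filter⁺; allFin⁺; take⁺)
open import Data.Nat using (ℕ; zero; suc; _+_; _*_; _∸_; _≤_; _<_; _^_; _≡ᵇ_; z≤n; s≤s)
open import Data.Nat.ListAction using (sum)
open import Data.Nat.Properties
  using (≤-decTotalOrder; +-*-semiring; ≤-trans; ≤-reflexive; m≤m+n; n≤0⇒n≡0;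
         +-comm; +-mono-≤; +-monoˡ-≤; +-monoʳ-≤; *-mono-≤; *-monoʳ-≤; *-identityˡ; *-identityʳ; +-identityʳ; m^n>0; ^-monoʳ-≤; m⊓n≤m;
         module ≤-Reasoning)
open import Data.List.Sort ≤-decTotalOrder using (sort-↭)
open import Data.Nat.Tactic.RingSolver using (solve-∀)
open import Function using (id)
open import Data.Product using (∃; _×_; _,_; proj₁; proj₂)
open import Relation.Binary.Definitions using (tri<; tri≈; tri>)
open import Relation.Binary.PropositionalEquality
  using (_≡_; _≢_; refl; sym; trans; cong; cong₂; subst; module ≡-Reasoning)
open import Relation.Binary.PropositionalEquality.Properties using (setoid)
open import Relation.Nullary using (Dec; does; yes; no)
open import Relation.Nullary.Decidable using (T?; dec-true; dec-false)

open import Algebra.Properties.Semiring.Sum +-*-semiring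
  using (sum-syntax; sum-cong-≗; sum-remove; sum-replicate-zero; ∑-distrib-+; ∑-comm;
         *-distribˡ-sum; *-distribʳ-sum)
  renaming (sum to ∑)

𝟙 : Bool → ℕ
𝟙 true  = 1
𝟙 false = 0

𝟙≤1 : ∀ b → 𝟙 b ≤ 1
𝟙≤1 true  = s≤s z≤n
𝟙≤1 false = z≤n

𝟙≡0 : ∀ {b} → 𝟙 b ≡ 0 → b ≡ false
𝟙≡0 {false} _ = refl

𝟙-split : ∀ b c → 𝟙 b ≡ 𝟙 (b ∧ c) + 𝟙 (b ∧ not c)
𝟙-split false c     = refl
𝟙-split true  true  = refl
𝟙-split true  false = refl

𝟙-∧ : ∀ b c → 𝟙 (b ∧ c) ≡ 𝟙 b * 𝟙 c
𝟙-∧ false c     = refl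
𝟙-∧ true  true  = refl
𝟙-∧ true  false = refl

∧-true : ∀ {a b} → a ∧ b ≡ true → a ≡ true × b ≡ true
∧-true {true} {true} refl = refl , refl

does-false⇒≢ : ∀ {n} {u v : Fin n} → does (u ≟ v) ≡ false → u ≢ v
does-false⇒≢ {u = u} {v} h u≡v with () ← trans (sym (dec-true (u ≟ v) u≡v)) h

∑-mono : ∀ {n} {f g : Fin n → ℕ} → (∀ i → f i ≤ g i) → ∑ f ≤ ∑ g
∑-mono {zero}  _   = z≤n
∑-mono {suc n} f≤g = +-mono-≤ (f≤g zero) (∑-mono (λ i → f≤g (suc i)))

∑-ones : ∀ n → ∑[ i < n ] 1 ≡ n
∑-ones zero    = refl
∑-ones (suc n) = cong suc (∑-ones n)

term≤∑ : ∀ {n} (f : Fin n → ℕ) i → f i ≤ ∑ f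
term≤∑ {suc n} f i = ≤-trans (m≤m+n (f i) _) (≤-reflexive (sym (sum-remove {i = i} f)))

∑-delta : ∀ {n} (a : Fin n) (g : Fin n → ℕ) → ∑[ v < n ] (𝟙 (does (v ≟ a)) * g v) ≡ g a
∑-delta {suc n} zero    g = trans (cong₂ _+_ (*-identityˡ (g zero)) (sum-replicate-zero n)) (+-identityʳ _)
∑-delta {suc n} (suc a) g = ∑-delta a (λ v → g (suc v))

count : ∀ {n} → (Fin n → Bool) → ℕ
count {n} P = ∑[ v < n ] 𝟙 (P v)

count-cong : ∀ {n} {P Q : Fin n → Bool} → (∀ v → P v ≡ Q v) → count P ≡ count Q
count-cong P≡Q = sum-cong-≗ (λ v → cong 𝟙 (P≡Q v))

count-split : ∀ {n} (P Q : Fin n → Bool) →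
  count P ≡ count (λ v → P v ∧ Q v) + count (λ v → P v ∧ not (Q v))
count-split P Q = trans (sum-cong-≗ (λ v → 𝟙-split (P v) (Q v)))
  (∑-distrib-+ (λ v → 𝟙 (P v ∧ Q v)) (λ v → 𝟙 (P v ∧ not (Q v))))

count-≟ : ∀ {n} (a : Fin n) → count (λ v → does (v ≟ a)) ≡ 1
count-≟ {n} a = trans (sum-cong-≗ {n} (λ v → sym (*-identityʳ _))) (∑-delta a (λ _ → 1))

count-≤1 : ∀ {n} (P : Fin n → Bool) → (∀ u v → P u ≡ true → P v ≡ true → u ≡ v) → count P ≤ 1
count-≤1 {zero}  P unique = z≤n
count-≤1 {suc n} P unique with P zero in P0
... | false = count-≤1 (λ v → P (suc v)) (λ u v Pu Pv → suc-injective (unique _ _ Pu Pv))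
... | true  = s≤s (≤-reflexive (trans (sum-cong-≗ rest-empty) (sum-replicate-zero n)))
  where
  rest-empty : ∀ v → 𝟙 (P (suc v)) ≡ 0
  rest-empty v with P (suc v) in Pv
  ... | false = refl
  ... | true with () ← unique zero (suc v) P0 Pv

count-≤-2^ : ∀ {n} {A : Set} (R : Fin n → A → Bool) (T : List A) (P : Fin n → Bool) →
  (∀ u v → P u ≡ true → P v ≡ true → (∀ t → t ∈ T → R u t ≡ R v t) → u ≡ v) →
  count P ≤ 2 ^ length T
count-≤-2^ R []      P separated = count-≤1 P (λ u v Pu Pv → separated u v Pu Pv (λ _ ()))
count-≤-2^ R (t ∷ T) P separated = begin
  count P                                                            ≡⟨ count-split P (λ v → R v t) ⟩
  count (λ v → P v ∧ R v t) + count (λ v → P v ∧ not (R v t))        ≤⟨ +-mono-≤ (count-≤-2^ R T _ (on-side id id-same))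
                                                                                   (count-≤-2^ R T _ (on-side not not-same)) ⟩
  2 ^ length T + 2 ^ length T                                        ≡⟨ cong (2 ^ length T +_) (sym (+-identityʳ _)) ⟩
  2 ^ suc (length T)                                                 ∎
  where
  open ≤-Reasoning
  id-same : ∀ {a b} → a ≡ true → b ≡ true → a ≡ b
  id-same a≡ b≡ = trans a≡ (sym b≡)
  not-same : ∀ {a b} → not a ≡ true → not b ≡ true → a ≡ b
  not-same {false} {false} _ _ = refl
  on-side : (side : Bool → Bool) → (∀ {a b} → side a ≡ true → side b ≡ true → a ≡ b) →
    ∀ u v → P u ∧ side (R u t) ≡ true → P v ∧ side (R v t) ≡ true →
    (∀ s → s ∈ T → R u s ≡ R v s) → u ≡ v
  on-side side same u v Pu∧ Pv∧ agree with ∧-true {P u} Pu∧ | ∧-true {P v} Pv∧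
  ... | Pu , side-u | Pv , side-v = separated u v Pu Pv λ where
    s (here refl)  → same side-u side-v
    s (there s∈T) → agree s s∈T

pairCount : ∀ {n} → (Fin n → Fin n → Bool) → ℕ
pairCount {n} R = ∑[ v < n ] count (R v)

pairCount-cong : ∀ {n} {R R′ : Fin n → Fin n → Bool} → (∀ v w → R v w ≡ R′ v w) →
  pairCount R ≡ pairCount R′
pairCount-cong R≡R′ = sum-cong-≗ (λ v → count-cong (R≡R′ v))

pairCount-split : ∀ {n} (R c : Fin n → Fin n → Bool) →
  pairCount R ≡ pairCount (λ v w → R v w ∧ c v w) + pairCount (λ v w → R v w ∧ not (c v w))
pairCount-split R c = trans (sum-cong-≗ (λ v → count-split (R v) (c v)))
  (∑-distrib-+ (λ v → count (λ w → R v w ∧ c v w)) (λ v → count (λ w → R v w ∧ not (c v w))))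

pairCount-transpose : ∀ {n} (R : Fin n → Fin n → Bool) → pairCount R ≡ pairCount (λ v w → R w v)
pairCount-transpose R = ∑-comm (λ v w → 𝟙 (R v w))

pairCount-product : ∀ {n} (P Q : Fin n → Bool) → pairCount (λ v w → P v ∧ Q w) ≡ count P * count Q
pairCount-product {n} P Q = begin
  ∑[ v < n ] count (λ w → P v ∧ Q w)  ≡⟨ sum-cong-≗ (λ v → trans (sum-cong-≗ (λ w → 𝟙-∧ (P v) (Q w)))
                                                                  (sym (*-distribˡ-sum (𝟙 (P v)) (λ w → 𝟙 (Q w))))) ⟩
  ∑[ v < n ] (𝟙 (P v) * count Q)      ≡⟨ sym (*-distribʳ-sum (count Q) (λ v → 𝟙 (P v))) ⟩
  count P * count Q                   ∎
  where open ≡-Reasoning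

_∈?_ : ∀ {n} (v : Fin n) (S : List (Fin n)) → Dec (v ∈ S)
v ∈? S = any? (v ≟_) S

sum-over-list : ∀ {n} (S : List (Fin n)) → Unique S → (g : Fin n → ℕ) →
  sum (map g S) ≡ ∑[ v < n ] (𝟙 (does (v ∈? S)) * g v)
sum-over-list {n} []      []           g = sym (sum-replicate-zero n)
sum-over-list {n} (a ∷ S) (a∉S ∷ uniq) g = begin
  g a + sum (map g S)
    ≡⟨ cong₂ _+_ (sym (∑-delta a g)) (sum-over-list S uniq g) ⟩
  ∑[ v < n ] (𝟙 (does (v ≟ a)) * g v) + ∑[ v < n ] (𝟙 (does (v ∈? S)) * g v)
    ≡⟨ sym (∑-distrib-+ (λ v → 𝟙 (does (v ≟ a)) * g v) (λ v → 𝟙 (does (v ∈? S)) * g v)) ⟩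
  ∑[ v < n ] (𝟙 (does (v ≟ a)) * g v + 𝟙 (does (v ∈? S)) * g v)
    ≡⟨ sum-cong-≗ (λ v → sym (𝟙-∨-disjoint (g v) (a-fresh v))) ⟩
  ∑[ v < n ] (𝟙 (does (v ∈? (a ∷ S))) * g v) ∎
  where
  open ≡-Reasoning
  𝟙-∨-disjoint : ∀ {b c} m → (b ≡ true → c ≡ false) → 𝟙 (b ∨ c) * m ≡ 𝟙 b * m + 𝟙 c * m
  𝟙-∨-disjoint {false} m _   = refl
  𝟙-∨-disjoint {true}  m b⇒c rewrite b⇒c refl = sym (+-identityʳ _)
  a-fresh : ∀ v → does (v ≟ a) ≡ true → does (v ∈? S) ≡ false
  a-fresh v v≟a with v ≟ a
  ... | yes refl = dec-false (a ∈? S) (λ a∈S → All.lookup a∉S a∈S refl)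

count-∈ : ∀ {n} (S : List (Fin n)) → Unique S → count (λ v → does (v ∈? S)) ≡ length S
count-∈ {n} S uniq = begin
  count (λ v → does (v ∈? S))              ≡⟨ sum-cong-≗ {n} (λ v → sym (*-identityʳ _)) ⟩
  ∑[ v < n ] (𝟙 (does (v ∈? S)) * 1)       ≡⟨ sym (sum-over-list S uniq (λ _ → 1)) ⟩
  sum (map (λ _ → 1) S)                    ≡⟨ sum-ones S ⟩
  length S                                 ∎
  where
  open ≡-Reasoning
  sum-ones : ∀ {A : Set} (xs : List A) → sum (map (λ _ → 1) xs) ≡ length xs
  sum-ones []       = refl
  sum-ones (_ ∷ xs) = cong suc (sum-ones xs)

n<2^n : ∀ k → k < 2 ^ k
n<2^n zero    = s≤s z≤n
n<2^n (suc k) = begin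
  suc (suc k)        ≡⟨ +-comm 1 (suc k) ⟩
  suc k + 1          ≤⟨ +-mono-≤ (n<2^n k) (m^n>0 2 k) ⟩
  2 ^ k + 2 ^ k      ≡⟨ cong (2 ^ k +_) (sym (+-identityʳ _)) ⟩
  2 ^ suc k          ∎
  where open ≤-Reasoning

everyone : ∀ {n} → Fin n → Bool
everyone _ = true

∧-swap : ∀ p q r → p ∧ q ∧ r ≡ q ∧ p ∧ r
∧-swap false false r = refl
∧-swap false true  r = refl
∧-swap true  false r = refl
∧-swap true  true  r = refl

∧-shuffle : ∀ p q r a → (p ∧ q ∧ a) ∧ r ≡ p ∧ (q ∧ r) ∧ a
∧-shuffle false q     r a = refl
∧-shuffle true  false r a = refl
∧-shuffle true  true  r a = ∧-comm a r

𝟙-∧-≤ : ∀ p q a → 𝟙 (p ∧ q ∧ a) ≤ 𝟙 (p ∧ q)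
𝟙-∧-≤ false q     a = z≤n
𝟙-∧-≤ true  false a = z≤n
𝟙-∧-≤ true  true  a = 𝟙≤1 a

module Graph {n} (adj : Fin n → Fin n → Bool)
  (adj-sym : ∀ v w → adj v w ≡ adj w v) (adj-irrefl : ∀ v → adj v v ≡ false) where

  deg : Fin n → ℕ
  deg v = count (adj v)

  edges : ℕ
  edges = pairCount (λ v w → adj v w ∧ does (v <? w))

  handshake : pairCount adj ≡ 2 * edges
  handshake = begin
    pairCount adj                                                ≡⟨ pairCount-split adj (λ v w → does (v <? w)) ⟩
    edges + pairCount (λ v w → adj v w ∧ not (does (v <? w)))    ≡⟨ cong (edges +_) (pairCount-transpose (λ v w → adj v w ∧ not (does (v <? w)))) ⟩
    edges + pairCount (λ v w → adj w v ∧ not (does (w <? v)))    ≡⟨ cong (edges +_) (pairCount-cong reversed) ⟩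
    edges + edges                                                ≡⟨ cong (edges +_) (sym (+-identityʳ edges)) ⟩
    2 * edges                                                    ∎
    where
    open ≡-Reasoning
    reversed : ∀ v w → adj w v ∧ not (does (w <? v)) ≡ adj v w ∧ does (v <? w)
    reversed v w with <-cmp v w
    ... | tri< v<w _ w≮v rewrite dec-true (v <? w) v<w | dec-false (w <? v) w≮v = cong (_∧ true) (adj-sym w v)
    ... | tri≈ _ refl _ rewrite adj-irrefl v = refl
    ... | tri> v≮w _ w<v rewrite dec-true (w <? v) w<v | dec-false (v <? w) v≮w = cong (_∧ false) (adj-sym w v)

  between : (Fin n → Bool) → (Fin n → Bool) → ℕ
  between P Q = pairCount (λ v w → P v ∧ Q w ∧ adj v w)

  between-sym : ∀ (P Q : Fin n → Bool) → between P Q ≡ between Q P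
  between-sym P Q = trans (pairCount-transpose (λ v w → P v ∧ Q w ∧ adj v w)) (pairCount-cong λ v w →
    trans (∧-swap (P w) (Q v) (adj w v)) (cong (λ a → Q v ∧ P w ∧ a) (adj-sym w v)))

  between-split : ∀ (P Q R : Fin n → Bool) →
    between P Q ≡ between P (λ w → Q w ∧ R w) + between P (λ w → Q w ∧ not (R w))
  between-split P Q R = trans (pairCount-split (λ v w → P v ∧ Q w ∧ adj v w) (λ _ w → R w)) (cong₂ _+_
    (pairCount-cong λ v w → ∧-shuffle (P v) (Q w) (R w) (adj v w))
    (pairCount-cong λ v w → ∧-shuffle (P v) (Q w) (not (R w)) (adj v w)))

  between-≤ : ∀ (P Q : Fin n → Bool) → between P Q ≤ count P * count Q
  between-≤ P Q = ≤-trans (∑-mono λ v → ∑-mono λ w → 𝟙-∧-≤ (P v) (Q w) (adj v w))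
                          (≤-reflexive (pairCount-product P Q))

  module Split (S : List (Fin n)) (uniq : Unique S) where

    inS outS : Fin n → Bool
    inS v  = does (v ∈? S)
    outS v = not (inS v)

    degree-sum : sum (map deg S) ≡ between inS everyone
    degree-sum = trans (sum-over-list S uniq deg) (sum-cong-≗ λ v →
      trans (*-distribˡ-sum (𝟙 (inS v)) (λ w → 𝟙 (adj v w))) (sum-cong-≗ λ w → sym (𝟙-∧ (inS v) (adj v w))))

    double-count : 2 * between inS everyone + between outS outS ≡ between inS inS + 2 * edges
    double-count = begin
      2 * T + XX                   ≡⟨ twice T XX ⟩
      T + (T + XX)                 ≡⟨ cong (λ t → T + (t + XX)) (between-split inS everyone inS) ⟩
      T + ((SS + SX) + XX)         ≡⟨ regroup T SS SX XX ⟩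
      SS + (T + (SX + XX))         ≡⟨ cong (SS +_) (sym edges≡) ⟩
      SS + 2 * edges               ∎
      where
      open ≡-Reasoning
      T SS SX XX : ℕ
      T  = between inS everyone
      SS = between inS inS
      SX = between inS outS
      XX = between outS outS
      twice : ∀ t x → 2 * t + x ≡ t + (t + x)
      twice = solve-∀
      regroup : ∀ t a b c → t + ((a + b) + c) ≡ a + (t + (b + c))
      regroup = solve-∀
      edges≡ : 2 * edges ≡ T + (SX + XX)
      edges≡ = begin
        2 * edges                                         ≡⟨ sym handshake ⟩
        between everyone everyone                         ≡⟨ between-split everyone everyone inS ⟩
        between everyone inS + between everyone outS      ≡⟨ cong₂ _+_ (between-sym everyone inS) (between-sym everyone outS) ⟩
        T + between outS everyone                         ≡⟨ cong (T +_) (between-split outS everyone inS) ⟩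
        T + (between outS inS + XX)                       ≡⟨ cong (λ e → T + (e + XX)) (between-sym outS inS) ⟩
        T + (SX + XX)                                     ∎

    -- The case analysis behind the vertex count: for b = "in S", e = "is x" and
    -- d = number of neighbours outside S, every vertex contributes at least one
    -- to the right-hand side; the last summand marks the vertices outside S,
    -- other than x, all of whose neighbours lie in S.
    cover : ∀ b e d → 1 ≤ 𝟙 b + (d + (𝟙 e + 𝟙 (not b ∧ not e ∧ (d ≡ᵇ 0))))
    cover true  e     d       = s≤s z≤n
    cover false e     (suc d) = s≤s z≤n
    cover false true  zero    = s≤s z≤n
    cover false false zero    = s≤s z≤n

    lonely-parts : ∀ {b e d} → not b ∧ not e ∧ (d ≡ᵇ 0) ≡ true → b ≡ false × e ≡ false × d ≡ 0
    lonely-parts {false} {false} {zero} refl = refl , refl , refl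

    outDeg : Fin n → ℕ
    outDeg v = count (λ w → outS v ∧ outS w ∧ adj v w)

    no-outside-neighbour : ∀ u → inS u ≡ false → outDeg u ≡ 0 → ∀ w → inS w ≡ false → adj u w ≡ false
    no-outside-neighbour u u∉S isolated w w∉S = 𝟙≡0 (n≤0⇒n≡0 (begin
      𝟙 (adj u w)                             ≡⟨ cong₂ (λ a b → 𝟙 (not a ∧ not b ∧ adj u w)) u∉S w∉S ⟨
      𝟙 (outS u ∧ outS w ∧ adj u w)           ≤⟨ term≤∑ (λ w → 𝟙 (outS u ∧ outS w ∧ adj u w)) w ⟩
      outDeg u                                ≡⟨ isolated ⟩
      0                                       ∎))
      where open ≤-Reasoning

    module CloneFree (x : Fin n)
      (no-clones : ∀ u v → u ≢ x → v ≢ x → (∀ w → adj u w ≡ adj v w) → u ≡ v) where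

      lonely : Fin n → Bool
      lonely v = outS v ∧ not (does (v ≟ x)) ∧ (outDeg v ≡ᵇ 0)

      lonely-separated : ∀ u v → lonely u ≡ true → lonely v ≡ true →
        (∀ w → w ∈ S → adj u w ≡ adj v w) → u ≡ v
      lonely-separated u v lonely-u lonely-v agree
        with u∉S , u-not-x , isolated-u ← lonely-parts {inS u} lonely-u
           | v∉S , v-not-x , isolated-v ← lonely-parts {inS v} lonely-v
        = no-clones u v (does-false⇒≢ u-not-x) (does-false⇒≢ v-not-x) same-neighbours
        where
        same-neighbours : ∀ w → adj u w ≡ adj v w
        same-neighbours w with w ∈? S
        ... | yes w∈S = agree w w∈S
        ... | no  w∉S = trans (no-outside-neighbour u u∉S isolated-u w (dec-false (w ∈? S) w∉S))
                         (sym (no-outside-neighbour v v∉S isolated-v w (dec-false (w ∈? S) w∉S)))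

      vertex-bound : n ≤ length S + (between outS outS + (1 + 2 ^ length S))
      vertex-bound = begin
        n                                                        ≡⟨ ∑-ones n ⟨
        ∑[ v < n ] 1                                             ≤⟨ ∑-mono (λ v → cover (inS v) (does (v ≟ x)) (outDeg v)) ⟩
        ∑[ v < n ] (𝟙 (inS v) + (outDeg v + (𝟙 (does (v ≟ x)) + 𝟙 (lonely v))))
          ≡⟨ ∑-distrib-+ (λ v → 𝟙 (inS v)) (λ v → outDeg v + (𝟙 (does (v ≟ x)) + 𝟙 (lonely v))) ⟩
        count inS + ∑[ v < n ] (outDeg v + (𝟙 (does (v ≟ x)) + 𝟙 (lonely v)))
          ≡⟨ cong₂ _+_ (count-∈ S uniq) (trans (∑-distrib-+ outDeg (λ v → 𝟙 (does (v ≟ x)) + 𝟙 (lonely v)))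
                (cong (between outS outS +_) (∑-distrib-+ (λ v → 𝟙 (does (v ≟ x))) (λ v → 𝟙 (lonely v))))) ⟩
        length S + (between outS outS + (count (λ v → does (v ≟ x)) + count lonely))
          ≤⟨ +-monoʳ-≤ (length S) (+-monoʳ-≤ (between outS outS)
               (+-mono-≤ (≤-reflexive (count-≟ x)) (count-≤-2^ adj S lonely lonely-separated))) ⟩
        length S + (between outS outS + (1 + 2 ^ length S))    ∎
        where open ≤-Reasoning

      degree-bound : 2 * sum (map deg S) + n ≤ 2 * edges + length S * length S + 2 * 2 ^ length S
      degree-bound = begin
        2 * sum (map deg S) + n             ≡⟨ cong (λ t → 2 * t + n) degree-sum ⟩
        2 * T + n                           ≤⟨ +-monoʳ-≤ (2 * T) vertex-bound ⟩
        2 * T + (K + (XX + (1 + 2 ^ K)))    ≡⟨ regroup (2 * T) K XX (2 ^ K) ⟩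
        (2 * T + XX) + (suc K + 2 ^ K)      ≡⟨ cong (_+ (suc K + 2 ^ K)) double-count ⟩
        SS + 2 * edges + (suc K + 2 ^ K)    ≤⟨ +-mono-≤ (+-monoˡ-≤ (2 * edges) SS≤K²) (+-monoˡ-≤ (2 ^ K) (n<2^n K)) ⟩
        K * K + 2 * edges + (2 ^ K + 2 ^ K) ≡⟨ reorder (K * K) edges (2 ^ K) ⟩
        2 * edges + K * K + 2 * 2 ^ K       ∎
        where
        open ≤-Reasoning
        K T SS XX : ℕ
        K  = length S
        T  = between inS everyone
        SS = between inS inS
        XX = between outS outS
        SS≤K² : SS ≤ K * K
        SS≤K² = subst (λ c → SS ≤ c * c) (count-∈ S uniq) (between-≤ inS inS)
        regroup : ∀ t k e p → t + (k + (e + (1 + p))) ≡ (t + e) + (suc k + p)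
        regroup = solve-∀
        reorder : ∀ q e p → q + 2 * e + (p + p) ≡ 2 * e + q + 2 * p
        reorder = solve-∀

      degree-bound-≤ : ∀ k → length S ≤ k → 2 * sum (map deg S) + n ≤ 2 * edges + k * k + 2 * 2 ^ k
      degree-bound-≤ k K≤k = ≤-trans degree-bound
        (+-mono-≤ (+-monoʳ-≤ (2 * edges) (*-mono-≤ K≤k K≤k)) (*-monoʳ-≤ 2 (^-monoʳ-≤ 2 K≤k)))

length-filterᵇ-∷ : ∀ {A : Set} (p : A → Bool) y ys →
  length (filterᵇ p (y ∷ ys)) ≡ 𝟙 (p y) + length (filterᵇ p ys)
length-filterᵇ-∷ p y ys with p y
... | true  = refl
... | false = refl

length-filterᵇ-tabulate : ∀ {A : Set} {n} (p : A → Bool) (f : Fin n → A) →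
  length (filterᵇ p (tabulate f)) ≡ ∑[ i < n ] 𝟙 (p (f i))
length-filterᵇ-tabulate {n = zero}  p f = refl
length-filterᵇ-tabulate {n = suc n} p f = trans (length-filterᵇ-∷ p (f zero) _)
  (cong (𝟙 (p (f zero)) +_) (length-filterᵇ-tabulate p (λ i → f (suc i))))

length-filterᵇ-concatMap : ∀ {A B : Set} {n} (p : B → Bool) (g : A → List B) (f : Fin n → A) →
  length (filterᵇ p (concatMap g (tabulate f))) ≡ ∑[ i < n ] length (filterᵇ p (g (f i)))
length-filterᵇ-concatMap {n = zero}  p g f = refl
length-filterᵇ-concatMap {n = suc n} p g f = begin
  length (filterᵇ p (g (f zero) ++ rest))               ≡⟨ cong length (filter-++ (λ b → T? (p b)) (g (f zero)) rest) ⟩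
  length (filterᵇ p (g (f zero)) ++ filterᵇ p rest)     ≡⟨ length-++ (filterᵇ p (g (f zero))) ⟩
  length (filterᵇ p (g (f zero))) + length (filterᵇ p rest)
    ≡⟨ cong (length (filterᵇ p (g (f zero))) +_) (length-filterᵇ-concatMap p g (λ i → f (suc i))) ⟩
  ∑[ i < suc n ] length (filterᵇ p (g (f i)))          ∎
  where
  open ≡-Reasoning
  rest = concatMap g (tabulate (λ i → f (suc i)))

does-≟-sym : ∀ {n} (a b : Fin n) → does (a ≟ b) ≡ does (b ≟ a)
does-≟-sym a b with a ≟ b
... | yes refl = sym (dec-true (a ≟ a) refl)
... | no  a≢b  = sym (dec-false (b ≟ a) (λ b≡a → a≢b (sym b≡a)))

module Link {n} (D : TSet n) (x : Fin n) where

  linkAdj-sym : ∀ a b → linkAdj D x a b ≡ linkAdj D x b a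
  linkAdj-sym a b = trans
    (cong₂ (λ e o → not (does (a ≟ x)) ∧ not (does (b ≟ x)) ∧ not e ∧ o) (does-≟-sym a b)
      (cong or (map-cong (λ t → cong (λ z → D t ∧ (x ∈ₜ t) ∧ z) (∧-comm (a ∈ₜ t) (b ∈ₜ t))) (triples n))))
    (∧-swap (not (does (a ≟ x))) (not (does (b ≟ x))) _)

  linkAdj-irrefl : ∀ a → linkAdj D x a a ≡ false
  linkAdj-irrefl a rewrite dec-true (a ≟ a) refl = ∧-false (not (does (a ≟ x)))
    where
    ∧-false : ∀ p → p ∧ p ∧ false ≡ false
    ∧-false false = refl
    ∧-false true  = refl

  open Graph (linkAdj D x) linkAdj-sym linkAdj-irrefl public

  degree≡deg : ∀ v → degree D x v ≡ deg v
  degree≡deg v = length-filterᵇ-tabulate (linkAdj D x v) id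

  edgeCount≡edges : edgeCount D x ≡ edges
  edgeCount≡edges = trans (length-filterᵇ-concatMap is-edge (λ a → map (a ,_) (allFin n)) id)
    (sum-cong-≗ λ a → trans (cong (λ l → length (filterᵇ is-edge l)) (map-tabulate id (a ,_)))
                            (length-filterᵇ-tabulate is-edge (a ,_)))
    where
    is-edge : Fin n × Fin n → Bool
    is-edge p = linkAdj D x (proj₁ p) (proj₂ p) ∧ does (proj₁ p <? proj₂ p)

  topSum-of-vertices : ∀ k → ∃ λ S → Unique S × length S ≤ k × topSum D x k ≡ sum (map deg S)
  topSum-of-vertices k = S , uniq , length-take≤ , top≡
    where
    -- degreeSeq is a permutation of the degrees of the link vertices, so it
    -- lists the degrees of a reordering ys of those vertices.
    sorted↭ : map (degree D x) (linkVerts x) ↭ degreeSeq D x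
    sorted↭ = ↭-sym (↭-trans (↭-reverse _) (sort-↭ _))
    reordering : ∃ λ ys → degreeSeq D x ≡ map (degree D x) ys × linkVerts x ↭ ys
    reordering = ↭-map-inv (degree D x) sorted↭
    ys : List (Fin n)
    ys = proj₁ reordering
    S : List (Fin n)
    S = take k ys
    uniq : Unique S
    uniq = take⁺ k (Unique-resp-↭ (setoid (Fin n)) (↭⇒↭ₛ (proj₂ (proj₂ reordering)))
                      (filter⁺ (λ v → T? (not (does (v ≟ x)))) (allFin⁺ n)))
    length-take≤ : length S ≤ k
    length-take≤ = ≤-trans (≤-reflexive (length-take k ys)) (m⊓n≤m k _)
    top≡ : topSum D x k ≡ sum (map deg S)
    top≡ = begin
      sum (take k (degreeSeq D x))       ≡⟨ cong (λ l → sum (take k l)) (proj₁ (proj₂ reordering)) ⟩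
      sum (take k (map (degree D x) ys)) ≡⟨ cong sum (take-map k ys) ⟩
      sum (map (degree D x) S)           ≡⟨ cong sum (map-cong degree≡deg S) ⟩
      sum (map deg S)                    ∎
      where open ≡-Reasoning

claim4 : (n : ℕ) (C : TSet n) (x : Fin n) → Hypercut C →
    Connected (compl C) x → NoClones (compl C) x →
    (k : ℕ) → 1 ≤ k → k ≤ n ∸ 1 →
    2 * topSum (compl C) x k + n ≤ 2 * edgeCount (compl C) x + k * k + 2 * 2 ^ k
claim4 n C x _ _ no-clones k _ _ =
  let S , uniq , |S|≤k , top≡ = topSum-of-vertices k in
  begin
    2 * topSum (compl C) x k + n         ≡⟨ cong (λ t → 2 * t + n) top≡ ⟩
    2 * sum (map deg S) + n              ≤⟨ Split.CloneFree.degree-bound-≤ S uniq x no-clones k |S|≤k ⟩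
    2 * edges + k * k + 2 * 2 ^ k        ≡⟨ cong (λ e → 2 * e + k * k + 2 * 2 ^ k) edgeCount≡edges ⟨
    2 * edgeCount (compl C) x + k * k + 2 * 2 ^ k ∎
  where
  open Link (compl C) x
  open ≤-Reasoning
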